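{- Let $G$ and $H$ be finite simple graphs and let $u\in V(G)$, $v\in V(H)$. Then \[\mathrm{dp}_{G\otimes H}((u,v))=\mathrm{dp}_G(u)\otimes\mathrm{dp}_H(v),\] where on the right $\otimes$ is the tensor product of polynomials defined below.
   Context: For a vertex $w$ of a simple graph $\Gamma$, the degree polynomial $\mathrm{dp}_\Gamma(w)$ is the polynomial whose coefficient of $x^{i}$ is the number of neighbours of $w$ having degree $i$ in $\Gamma$ ($0$ if $w$ is isolated). The tensor product of graphs $G\otimes H$ is the simple graph on $V(G)\times V(H)$ in which $(u_1,v_1)\sim(u_2,v_2)$ iff $u_1\sim u_2$ in $G$ and $v_1\sim v_2$ in $H$. For nonzero polynomials $f=\sum_{a_i\neq 0}a_i x^i$ and $g=\sum_{b_j\neq0}b_j x^j$ with nonnegative integer coefficients, their tensor product is $f\otimes g=\sum_t c_t x^t$, where $t$ ranges over the distinct products $i\cdot j$ with $a_i\neq 0$, $b_j\neq 0$, and $c_t=\sum_{i\cdot j=t}a_i b_j$; moreover $0\otimes f=f\otimes 0=0$. -}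

module Defs where

open import Data.Nat using (ℕ; zero; suc; _+_; _*_; _≡ᵇ_)
open import Data.Bool using (Bool; true; false; if_then_else_; _∧_)
open import Data.Fin using (Fin; combine; remQuot)
open import Data.List using (List; []; _∷_; map; upTo; allFin; length)
open import Data.Nat.ListAction using (sum)
open import Data.Product using (_,_)
open import Relation.Binary.PropositionalEquality using (_≡_)

record Graph : Set where
  field
    n     : ℕ
    adj   : Fin n → Fin n → Bool
    sym   : ∀ x y → adj x y ≡ adj y x
    irrefl : ∀ x → adj x x ≡ false

open Graph public

ind : Bool → ℕ
ind true  = 1
ind false = 0

deg : (G : Graph) → Fin (n G) → ℕ
deg G w = sum (map (λ x → ind (adj G w x)) (allFin (n G)))

-- Polynomials with nonnegative integer coefficients, as coefficient lists
-- (the i-th entry is the coefficient of x^i); trailing zeros are irrelevant.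
Poly : Set
Poly = List ℕ

coeff : Poly → ℕ → ℕ
coeff []       _       = 0
coeff (a ∷ p)  zero    = a
coeff (a ∷ p)  (suc i) = coeff p i

_≈P_ : Poly → Poly → Set
p ≈P q = ∀ t → coeff p t ≡ coeff q t

-- degree polynomial: coefficient of x^i = number of neighbours of w of degree i
-- (every degree is < n, so n coefficients suffice; isolated w gives 0)
dp : (G : Graph) → Fin (n G) → Poly
dp G w = map (λ i → sum (map (λ x → ind (adj G w x ∧ (deg G x ≡ᵇ i))) (allFin (n G))))
             (upTo (n G))

-- tensor product of polynomials: c_t = Σ_{i·j = t} a_i b_j
-- (terms with a_i = 0 or b_j = 0 contribute nothing; 0 ⊗ f = f ⊗ 0 = 0 automatically)
_⊗P_ : Poly → Poly → Poly
f ⊗P g = map c (upTo (length f * length g))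
  where
  c : ℕ → ℕ
  c t = sum (map (λ i → sum (map (λ j → if (i * j) ≡ᵇ t then coeff f i * coeff g j else 0)
                                 (upTo (length g))))
                 (upTo (length f)))

-- tensor product of graphs on Fin (n G * n H), vertex (u , v) ↦ combine u v
_⊗G_ : Graph → Graph → Graph
G ⊗G H = record
  { n = n G * n H
  ; adj = λ a b → A (remQuot (n H) a) (remQuot (n H) b)
  ; sym = λ a b → S (remQuot (n H) a) (remQuot (n H) b)
  ; irrefl = λ a → I (remQuot (n H) a)
  }
  where
  open import Data.Product using (_×_)
  open import Relation.Binary.PropositionalEquality using (cong₂; trans; refl)
  open import Data.Bool.Properties using (∧-zeroˡ)
  A : Fin (n G) × Fin (n H) → Fin (n G) × Fin (n H) → Bool
  A (u₁ , v₁) (u₂ , v₂) = adj G u₁ u₂ ∧ adj H v₁ v₂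
  S : ∀ p q → A p q ≡ A q p
  S (u₁ , v₁) (u₂ , v₂) = cong₂ _∧_ (sym G u₁ u₂) (sym H v₁ v₂)
  I : ∀ p → A p p ≡ false
  I (u , v) = trans (cong₂ _∧_ (irrefl G u) refl) (∧-zeroˡ (adj H v v))

-- A neighbour of (u , v) in G ⊗ H is a pair (x , y) of neighbours of u and v,
-- and its degree is deg x · deg y.  So the coefficient of degree t in the
-- degree polynomial of (u , v) counts the pairs of neighbours whose degrees
-- multiply to t; grouping the neighbours of u by their degree i and those of
-- v by their degree j turns this count into Σ_{i·j = t} a_i b_j.
module Submission where

open import Defs hiding (sym)
open import Data.Bool using (true; false; if_then_else_; _∧_)
open import Data.Fin using (Fin; zero; suc; toℕ; combine; _↑ˡ_; _↑ʳ_)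
open import Data.Fin.Properties using (toℕ<n; remQuot-combine)
open import Data.List using (map; upTo; applyUpTo; allFin; length; tabulate)
open import Data.List.Properties using (map-tabulate; map-upTo; length-map; length-upTo)
open import Data.Nat using (ℕ; zero; suc; _+_; _*_; _≡ᵇ_; _≤_; _<_; z≤n; s≤s)
open import Data.Nat.ListAction using (sum)
open import Data.Nat.Properties
  using (+-*-semiring; +-assoc; +-identityʳ; +-suc; +-mono-≤; *-assoc; *-identityʳ; *-zeroʳ; *-mono-<; <-≤-trans)
open import Data.Product using (proj₁; proj₂)
open import Function using (_∘_)
open import Relation.Binary.PropositionalEquality
  using (_≡_; refl; sym; trans; cong; cong₂; subst; module ≡-Reasoning)

open import Algebra.Properties.Semiring.Sum +-*-semiring
  using (sum-syntax; sum-cong-≗; sum-replicate-zero; ∑-comm; *-distribˡ-sum; *-distribʳ-sum)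

δ : ℕ → ℕ → ℕ
δ a b = ind (a ≡ᵇ b)

δ-< : ∀ {a b} → a < b → δ a b ≡ 0
δ-< {zero}  {suc b} _         = refl
δ-< {suc a} {suc b} (s≤s a<b) = δ-< a<b

ind-∧ : ∀ a b → ind (a ∧ b) ≡ ind a * ind b
ind-∧ true  b = sym (+-identityʳ (ind b))
ind-∧ false b = refl

ind≤1 : ∀ b → ind b ≤ 1
ind≤1 true  = s≤s z≤n
ind≤1 false = z≤n

if-then-0 : ∀ b x → (if b then x else 0) ≡ x * ind b
if-then-0 true  x = sym (*-identityʳ x)
if-then-0 false x = sym (*-zeroʳ x)

∑-zero : ∀ n {f : Fin n → ℕ} → (∀ i → f i ≡ 0) → ∑[ i < n ] f i ≡ 0
∑-zero n f≡0 = trans (sum-cong-≗ f≡0) (sum-replicate-zero n)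

∑-++ : ∀ m n (f : Fin (m + n) → ℕ) →
       ∑[ i < m + n ] f i ≡ ∑[ i < m ] f (i ↑ˡ n) + ∑[ j < n ] f (m ↑ʳ j)
∑-++ zero    n f = refl
∑-++ (suc m) n f = trans (cong (f zero +_) (∑-++ m n (f ∘ suc))) (sym (+-assoc (f zero) _ _))

∑-combine : ∀ m n (f : Fin (m * n) → ℕ) →
            ∑[ a < m * n ] f a ≡ ∑[ i < m ] ∑[ j < n ] f (combine i j)
∑-combine zero    n f = refl
∑-combine (suc m) n f =
  trans (∑-++ n (m * n) f) (cong ((∑[ j < n ] f (j ↑ˡ (m * n))) +_) (∑-combine m n (f ∘ (n ↑ʳ_))))

∑-*-∑ : ∀ m n (f : Fin m → ℕ) (g : Fin n → ℕ) →
        (∑[ i < m ] f i) * (∑[ j < n ] g j) ≡ ∑[ i < m ] ∑[ j < n ] (f i * g j)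
∑-*-∑ m n f g = trans (*-distribʳ-sum _ f) (sum-cong-≗ λ i → *-distribˡ-sum (f i) g)

∑-≤1⇒≤ : ∀ n (f : Fin n → ℕ) → (∀ i → f i ≤ 1) → ∑[ i < n ] f i ≤ n
∑-≤1⇒≤ zero    f f≤1 = z≤n
∑-≤1⇒≤ (suc n) f f≤1 = +-mono-≤ (f≤1 zero) (∑-≤1⇒≤ n (f ∘ suc) (f≤1 ∘ suc))

∑-≤1⇒< : ∀ n (f : Fin n → ℕ) (x : Fin n) → (∀ i → f i ≤ 1) → f x ≡ 0 → ∑[ i < n ] f i < n
∑-≤1⇒< (suc n) f zero    f≤1 fx≡0 rewrite fx≡0 = s≤s (∑-≤1⇒≤ n (f ∘ suc) (f≤1 ∘ suc))
∑-≤1⇒< (suc n) f (suc x) f≤1 fx≡0 =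
  subst (_≤ suc n) (+-suc (f zero) _) (+-mono-≤ (f≤1 zero) (∑-≤1⇒< n (f ∘ suc) x (f≤1 ∘ suc) fx≡0))

∑-δ : ∀ n d (w : ℕ → ℕ) → d < n → ∑[ i < n ] (δ d (toℕ i) * w (toℕ i)) ≡ w d
∑-δ (suc n) zero    w _         =
  trans (cong₂ _+_ (+-identityʳ (w 0)) (∑-zero n λ _ → refl)) (+-identityʳ (w 0))
∑-δ (suc n) (suc d) w (s≤s d<n) = ∑-δ n d (w ∘ suc) d<n

∑-pushforward : ∀ m n (a d : Fin m → ℕ) (w : ℕ → ℕ) → (∀ x → d x < n) →
  ∑[ i < n ] ((∑[ x < m ] (a x * δ (d x) (toℕ i))) * w (toℕ i)) ≡ ∑[ x < m ] (a x * w (d x))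
∑-pushforward m n a d w d<n = begin
  ∑[ i < n ] ((∑[ x < m ] (a x * δ (d x) (toℕ i))) * w (toℕ i))
    ≡⟨ sum-cong-≗ {n} (λ i → *-distribʳ-sum {m} (w (toℕ i)) _) ⟩
  ∑[ i < n ] ∑[ x < m ] (a x * δ (d x) (toℕ i) * w (toℕ i))
    ≡⟨ ∑-comm {n} {m} _ ⟩
  ∑[ x < m ] ∑[ i < n ] (a x * δ (d x) (toℕ i) * w (toℕ i))
    ≡⟨ sum-cong-≗ {m} (λ x → sum-cong-≗ {n} λ i → *-assoc (a x) _ _) ⟩
  ∑[ x < m ] ∑[ i < n ] (a x * (δ (d x) (toℕ i) * w (toℕ i)))
    ≡⟨ sum-cong-≗ {m} (λ x → *-distribˡ-sum {n} (a x) λ i → δ (d x) (toℕ i) * w (toℕ i)) ⟨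
  ∑[ x < m ] (a x * ∑[ i < n ] (δ (d x) (toℕ i) * w (toℕ i)))
    ≡⟨ sum-cong-≗ {m} (λ x → cong (a x *_) (∑-δ n (d x) w (d<n x))) ⟩
  ∑[ x < m ] (a x * w (d x)) ∎
  where open ≡-Reasoning

∑-pushforward₂ : ∀ m k M K (a d : Fin m → ℕ) (b e : Fin k → ℕ) (w : ℕ → ℕ → ℕ) →
  (∀ x → d x < M) → (∀ y → e y < K) →
  ∑[ i < M ] ∑[ j < K ]
    ((∑[ x < m ] (a x * δ (d x) (toℕ i))) * (∑[ y < k ] (b y * δ (e y) (toℕ j))) * w (toℕ i) (toℕ j))
  ≡ ∑[ x < m ] ∑[ y < k ] (a x * b y * w (d x) (e y))
∑-pushforward₂ m k M K a d b e w d<M e<K = begin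
  ∑[ i < M ] ∑[ j < K ] (A i * B j * w (toℕ i) (toℕ j))
    ≡⟨ sum-cong-≗ {M} (λ i → sum-cong-≗ {K} λ j → *-assoc (A i) _ _) ⟩
  ∑[ i < M ] ∑[ j < K ] (A i * (B j * w (toℕ i) (toℕ j)))
    ≡⟨ sum-cong-≗ {M} (λ i → *-distribˡ-sum {K} (A i) λ j → B j * w (toℕ i) (toℕ j)) ⟨
  ∑[ i < M ] (A i * ∑[ j < K ] (B j * w (toℕ i) (toℕ j)))
    ≡⟨ sum-cong-≗ {M} (λ i → cong (A i *_) (∑-pushforward k K b e (w (toℕ i)) e<K)) ⟩
  ∑[ i < M ] (A i * ∑[ y < k ] (b y * w (toℕ i) (e y)))
    ≡⟨ ∑-pushforward m M a d (λ i → ∑[ y < k ] (b y * w i (e y))) d<M ⟩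
  ∑[ x < m ] (a x * ∑[ y < k ] (b y * w (d x) (e y)))
    ≡⟨ sum-cong-≗ {m} (λ x → *-distribˡ-sum {k} (a x) λ y → b y * w (d x) (e y)) ⟩
  ∑[ x < m ] ∑[ y < k ] (a x * (b y * w (d x) (e y)))
    ≡⟨ sum-cong-≗ {m} (λ x → sum-cong-≗ {k} λ y → *-assoc (a x) _ _) ⟨
  ∑[ x < m ] ∑[ y < k ] (a x * b y * w (d x) (e y)) ∎
  where
  open ≡-Reasoning
  A : Fin M → ℕ
  A i = ∑[ x < m ] (a x * δ (d x) (toℕ i))
  B : Fin K → ℕ
  B j = ∑[ y < k ] (b y * δ (e y) (toℕ j))

sum-map-allFin : ∀ n (f : Fin n → ℕ) → sum (map f (allFin n)) ≡ ∑[ i < n ] f i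
sum-map-allFin n f = trans (cong sum (map-tabulate (λ i → i) f)) (sum-tabulate n f)
  where
  sum-tabulate : ∀ n (f : Fin n → ℕ) → sum (tabulate f) ≡ ∑[ i < n ] f i
  sum-tabulate zero    f = refl
  sum-tabulate (suc n) f = cong (f zero +_) (sum-tabulate n (f ∘ suc))

sum-map-upTo : ∀ n (f : ℕ → ℕ) → sum (map f (upTo n)) ≡ ∑[ i < n ] f (toℕ i)
sum-map-upTo n f = trans (cong sum (map-upTo f n)) (sum-applyUpTo n f)
  where
  sum-applyUpTo : ∀ n (f : ℕ → ℕ) → sum (applyUpTo f n) ≡ ∑[ i < n ] f (toℕ i)
  sum-applyUpTo zero    f = refl
  sum-applyUpTo (suc n) f = cong (f 0 +_) (sum-applyUpTo n (f ∘ suc))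

coeff-map-upTo : ∀ N (f F : ℕ → ℕ) → (∀ t → f t ≡ F t) → (∀ t → N ≤ t → F t ≡ 0) →
                 ∀ t → coeff (map f (upTo N)) t ≡ F t
coeff-map-upTo N f F f≡F F≡0 t =
  trans (cong (λ p → coeff p t) (map-upTo f N)) (coeff-applyUpTo N f F f≡F F≡0 t)
  where
  coeff-applyUpTo : ∀ N (f F : ℕ → ℕ) → (∀ t → f t ≡ F t) → (∀ t → N ≤ t → F t ≡ 0) →
                    ∀ t → coeff (applyUpTo f N) t ≡ F t
  coeff-applyUpTo zero    f F f≡F F≡0 t       = sym (F≡0 t z≤n)
  coeff-applyUpTo (suc N) f F f≡F F≡0 zero    = f≡F 0
  coeff-applyUpTo (suc N) f F f≡F F≡0 (suc t) =
    coeff-applyUpTo N (f ∘ suc) (F ∘ suc) (f≡F ∘ suc) (λ t N≤t → F≡0 (suc t) (s≤s N≤t)) t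

coeff-⊗P : ∀ {m k} (f g : Poly) → length f ≡ m → length g ≡ k → ∀ t →
  coeff (f ⊗P g) t ≡ ∑[ i < m ] ∑[ j < k ] (coeff f (toℕ i) * coeff g (toℕ j) * δ (toℕ i * toℕ j) t)
coeff-⊗P f g refl refl = coeff-map-upTo _ _ Conv as-∑ vanishes
  where
  Conv : ℕ → ℕ
  Conv t = ∑[ i < length f ] ∑[ j < length g ] (coeff f (toℕ i) * coeff g (toℕ j) * δ (toℕ i * toℕ j) t)
  as-∑ : ∀ t → sum (map (λ i → sum (map (λ j → if i * j ≡ᵇ t then coeff f i * coeff g j else 0)
                                         (upTo (length g))))
                        (upTo (length f)))
               ≡ Conv t
  as-∑ t = trans (sum-map-upTo (length f) _) (sum-cong-≗ {length f} λ i →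
             trans (sum-map-upTo (length g) _) (sum-cong-≗ {length g} λ j →
               if-then-0 (toℕ i * toℕ j ≡ᵇ t) _))
  vanishes : ∀ t → length f * length g ≤ t → Conv t ≡ 0
  vanishes t fg≤t = ∑-zero (length f) λ i → ∑-zero (length g) λ j →
    trans (cong (coeff f (toℕ i) * coeff g (toℕ j) *_)
                (δ-< (<-≤-trans (*-mono-< (toℕ<n i) (toℕ<n j)) fg≤t)))
          (*-zeroʳ (coeff f (toℕ i) * coeff g (toℕ j)))

deg<n : ∀ G x → deg G x < n G
deg<n G x = subst (_< n G) (sym (sum-map-allFin (n G) _))
  (∑-≤1⇒< (n G) (ind ∘ adj G x) x (ind≤1 ∘ adj G x) (cong ind (irrefl G x)))

length-dp : ∀ G u → length (dp G u) ≡ n G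
length-dp G u = trans (length-map _ (upTo (n G))) (length-upTo (n G))

coeff-dp : ∀ G u i → coeff (dp G u) i ≡ ∑[ x < n G ] (ind (adj G u x) * δ (deg G x) i)
coeff-dp G u = coeff-map-upTo (n G) _ Neighbours as-∑ vanishes
  where
  Neighbours : ℕ → ℕ
  Neighbours i = ∑[ x < n G ] (ind (adj G u x) * δ (deg G x) i)
  as-∑ : ∀ i → sum (map (λ x → ind (adj G u x ∧ (deg G x ≡ᵇ i))) (allFin (n G))) ≡ Neighbours i
  as-∑ i = trans (sum-map-allFin (n G) _) (sum-cong-≗ {n G} λ x → ind-∧ (adj G u x) _)
  vanishes : ∀ i → n G ≤ i → Neighbours i ≡ 0
  vanishes i n≤i = ∑-zero (n G) λ x →
    trans (cong (ind (adj G u x) *_) (δ-< (<-≤-trans (deg<n G x) n≤i))) (*-zeroʳ (ind (adj G u x)))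

adj-⊗G : ∀ G H u v x y → adj (G ⊗G H) (combine u v) (combine x y) ≡ (adj G u x ∧ adj H v y)
adj-⊗G G H u v x y =
  cong₂ _∧_ (cong₂ (adj G) (cong proj₁ uv) (cong proj₁ xy)) (cong₂ (adj H) (cong proj₂ uv) (cong proj₂ xy))
  where
  uv = remQuot-combine {n G} {n H} u v
  xy = remQuot-combine {n G} {n H} x y

deg-⊗G : ∀ G H x y → deg (G ⊗G H) (combine x y) ≡ deg G x * deg H y
deg-⊗G G H x y = begin
  deg (G ⊗G H) (combine x y)
    ≡⟨ sum-map-allFin (n G * n H) _ ⟩
  ∑[ a < n G * n H ] ind (adj (G ⊗G H) (combine x y) a)
    ≡⟨ ∑-combine (n G) (n H) _ ⟩
  ∑[ i < n G ] ∑[ j < n H ] ind (adj (G ⊗G H) (combine x y) (combine i j))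
    ≡⟨ sum-cong-≗ {n G} (λ i → sum-cong-≗ {n H} λ j →
         trans (cong ind (adj-⊗G G H x y i j)) (ind-∧ (adj G x i) (adj H y j))) ⟩
  ∑[ i < n G ] ∑[ j < n H ] (ind (adj G x i) * ind (adj H y j))
    ≡⟨ ∑-*-∑ (n G) (n H) _ _ ⟨
  (∑[ i < n G ] ind (adj G x i)) * (∑[ j < n H ] ind (adj H y j))
    ≡⟨ cong₂ _*_ (sum-map-allFin (n G) _) (sum-map-allFin (n H) _) ⟨
  deg G x * deg H y ∎
  where open ≡-Reasoning

coeff-dp-⊗G : ∀ G H u v t →
  coeff (dp (G ⊗G H) (combine u v)) t
  ≡ ∑[ x < n G ] ∑[ y < n H ] (ind (adj G u x) * ind (adj H v y) * δ (deg G x * deg H y) t)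
coeff-dp-⊗G G H u v t = begin
  coeff (dp (G ⊗G H) (combine u v)) t
    ≡⟨ coeff-dp (G ⊗G H) (combine u v) t ⟩
  ∑[ a < n G * n H ] (ind (adj (G ⊗G H) (combine u v) a) * δ (deg (G ⊗G H) a) t)
    ≡⟨ ∑-combine (n G) (n H) _ ⟩
  ∑[ x < n G ] ∑[ y < n H ]
    (ind (adj (G ⊗G H) (combine u v) (combine x y)) * δ (deg (G ⊗G H) (combine x y)) t)
    ≡⟨ sum-cong-≗ {n G} (λ x → sum-cong-≗ {n H} λ y → neighbour-pair x y) ⟩
  ∑[ x < n G ] ∑[ y < n H ] (ind (adj G u x) * ind (adj H v y) * δ (deg G x * deg H y) t) ∎
  where
  open ≡-Reasoning
  neighbour-pair : ∀ x y →
    ind (adj (G ⊗G H) (combine u v) (combine x y)) * δ (deg (G ⊗G H) (combine x y)) t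
    ≡ ind (adj G u x) * ind (adj H v y) * δ (deg G x * deg H y) t
  neighbour-pair x y = trans
    (cong₂ (λ e d → ind e * δ d t) (adj-⊗G G H u v x y) (deg-⊗G G H x y))
    (cong (_* δ (deg G x * deg H y) t) (ind-∧ (adj G u x) (adj H v y)))

theorem4p17 : (G H : Graph) (u : Fin (n G)) (v : Fin (n H)) →
    dp (G ⊗G H) (combine u v) ≈P (dp G u ⊗P dp H v)
theorem4p17 G H u v t = begin
  coeff (dp (G ⊗G H) (combine u v)) t
    ≡⟨ coeff-dp-⊗G G H u v t ⟩
  ∑[ x < n G ] ∑[ y < n H ] (ind (adj G u x) * ind (adj H v y) * δ (deg G x * deg H y) t)
    ≡⟨ ∑-pushforward₂ (n G) (n H) (n G) (n H) (ind ∘ adj G u) (deg G) (ind ∘ adj H v) (deg H)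
                      (λ i j → δ (i * j) t) (deg<n G) (deg<n H) ⟨
  ∑[ i < n G ] ∑[ j < n H ]
    ((∑[ x < n G ] (ind (adj G u x) * δ (deg G x) (toℕ i)))
      * (∑[ y < n H ] (ind (adj H v y) * δ (deg H y) (toℕ j))) * δ (toℕ i * toℕ j) t)
    ≡⟨ sum-cong-≗ {n G} (λ i → sum-cong-≗ {n H} λ j →
         cong₂ (λ p q → p * q * δ (toℕ i * toℕ j) t) (coeff-dp G u (toℕ i)) (coeff-dp H v (toℕ j))) ⟨
  ∑[ i < n G ] ∑[ j < n H ] (coeff (dp G u) (toℕ i) * coeff (dp H v) (toℕ j) * δ (toℕ i * toℕ j) t)
    ≡⟨ coeff-⊗P (dp G u) (dp H v) (length-dp G u) (length-dp H v) t ⟨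
  coeff (dp G u ⊗P dp H v) t ∎
  where open ≡-Reasoning
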